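{- Let $\phi\in\{f,g,h\}$ and $u\in\Sigma_3^\omega$. If $\phi(u)$ is rich, then $u$ is rich.
   Context: $\Sigma_k=\{0,1,\dots,k-1\}$. The morphisms $f:\Sigma_3^*\to\Sigma_2^*$ and $g,h:\Sigma_3^*\to\Sigma_3^*$ are defined by $f(0)=0$, $f(1)=01$, $f(2)=011$; $g(0)=011$, $g(1)=0121$, $g(2)=012121$; $h(0)=01$, $h(1)=02$, $h(2)=022$ (extended to infinite words letterwise). A finite word of length $n$ is rich if it has $n$ distinct nonempty palindromic factors; an infinite word is rich if all of its finite factors are rich. -}

module Defs where

open import Data.Nat using (ℕ; zero; suc; _+_)
open import Data.Fin using (Fin; zero; suc)
open import Data.List using (List; []; _∷_; _++_; length; reverse; concatMap; applyUpTo)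
open import Data.List.Membership.Propositional using (_∈_)
open import Data.List.Relation.Unary.Unique.Propositional using (Unique)
open import Data.Product using (Σ; ∃; ∃-syntax; _×_)
open import Relation.Binary.PropositionalEquality using (_≡_)
open import Relation.Nullary using (¬_)
open import Function.Bundles using (_⇔_)

Alph : ℕ → Set
Alph k = Fin k

Word : ℕ → Set
Word k = List (Alph k)

InfWord : ℕ → Set
InfWord k = ℕ → Alph k

`0 : ∀ {k} → Fin (suc k)
`0 = zero

`1 : ∀ {k} → Fin (suc (suc k))
`1 = suc zero

`2 : ∀ {k} → Fin (suc (suc (suc k)))
`2 = suc (suc zero)

_IsFactorOf_ : ∀ {k} → Word k → Word k → Set
w IsFactorOf v = ∃[ x ] ∃[ y ] (x ++ w ++ y ≡ v)

Palindrome : ∀ {k} → Word k → Set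
Palindrome w = reverse w ≡ w

NonEmpty : ∀ {k} → Word k → Set
NonEmpty w = ¬ (w ≡ [])

HasNPalFactors : ∀ {k} → Word k → ℕ → Set
HasNPalFactors {k} w n =
  Σ (List (Word k)) λ L →
    Unique L × (length L ≡ n) ×
    (∀ p → (p ∈ L) ⇔ (NonEmpty p × Palindrome p × p IsFactorOf w))

Rich : ∀ {k} → Word k → Set
Rich w = HasNPalFactors w (length w)

factor : ∀ {k} → InfWord k → ℕ → ℕ → Word k
factor u i n = applyUpTo (λ j → u (i + j)) n

RichInf : ∀ {k} → InfWord k → Set
RichInf u = ∀ i n → Rich (factor u i n)

Morphism : ℕ → ℕ → Set
Morphism m k = Alph m → Word k

applyFin : ∀ {m k} → Morphism m k → Word m → Word k
applyFin φ w = concatMap φ w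

prefix : ∀ {k} → InfWord k → ℕ → Word k
prefix u n = applyUpTo u n

lookupD : ∀ {k} → Alph k → Word k → ℕ → Alph k
lookupD d []       _       = d
lookupD d (a ∷ w)  zero    = a
lookupD d (a ∷ w)  (suc i) = lookupD d w i

-- extension to infinite words (letterwise, φ(u) = φ(u 0) φ(u 1) …),
-- valid for nonerasing morphisms: the n-th letter of φ(u) is the n-th
-- letter of φ(u 0 … u n), which has length ≥ n+1, so the default `0
-- is never used.
applyInf : ∀ {m k} → Morphism m (suc k) → InfWord m → InfWord (suc k)
applyInf φ u n = lookupD `0 (applyFin φ (prefix u (suc n))) n

f : Morphism 3 2
f zero             = `0 ∷ []
f (suc zero)       = `0 ∷ `1 ∷ []
f (suc (suc zero)) = `0 ∷ `1 ∷ `1 ∷ []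

g : Morphism 3 3
g zero             = `0 ∷ `1 ∷ `1 ∷ []
g (suc zero)       = `0 ∷ `1 ∷ `2 ∷ `1 ∷ []
g (suc (suc zero)) = `0 ∷ `1 ∷ `2 ∷ `1 ∷ `2 ∷ `1 ∷ []

h : Morphism 3 3
h zero             = `0 ∷ `1 ∷ []
h (suc zero)       = `0 ∷ `2 ∷ []
h (suc (suc zero)) = `0 ∷ `2 ∷ `2 ∷ []

-- Appending a letter to a word creates at most one new palindromic factor, namely its
-- longest palindromic suffix, so a word of length n has at most n palindromic factors
-- and it is rich exactly when no prefix va fails to create a new palindrome at a
-- (Droubay, Justin and Pirillo). Each of f, g, h sends a letter a to 0 sₐ, where sₐ is a
-- palindrome without 0 and a ↦ sₐ is injective. The 0s mark the letter boundaries, so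
-- the palindromic suffixes of φ(va)0 are exactly the words φ(q)0 with q a palindromic
-- suffix of va. Hence if va creates no new palindrome, neither does φ(va)0; and if u is
-- not rich, such a factor va of u exists, and φ(va)0 is a non-rich factor of φ(u).
module Submission where

open import Data.Empty using (⊥-elim)
import Data.Fin.Properties as Fin
open import Data.List using (List; []; _∷_; [_]; _++_; _∷ʳ_; length; reverse; drop; filter; applyUpTo; upTo)
open import Data.List.Properties
  using (++-assoc; ++-identityʳ; ++-conicalˡ; ++-conicalʳ; ∷-injective; ∷ʳ-injective; ≡-dec; length-++;
         reverse-++; unfold-reverse; concatMap-++; applyUpTo-∷ʳ; map-upTo; map-cong; length-applyUpTo)
open import Data.List.Reverse using (Reverse; reverseView; []; _∶_∶ʳ_)
open import Data.List.Membership.Propositional using (_∈_)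
open import Data.List.Membership.Propositional.Properties using (∈-filter⁻)
open import Data.List.Relation.Unary.All as All using (All; []; _∷_)
open import Data.List.Relation.Unary.AllPairs using ([]; _∷_)
open import Data.List.Relation.Unary.Any using (here; there)
open import Data.List.Relation.Unary.Unique.Propositional using (Unique)
open import Data.List.Relation.Unary.Unique.Propositional.Properties using (filter⁺)
open import Data.Nat using (ℕ; zero; suc; _+_; _≤_; _<_; z≤n; s≤s)
open import Data.Nat.Properties using (+-comm; +-suc; +-identityʳ; +-mono-≤; ≤-trans; ≤-reflexive; ≤-total; 1+n≰n; m<m+n; m≤n⇒∃[o]m+o≡n)
open import Data.Product using (∃-syntax; _×_; _,_; proj₁; proj₂)
open import Data.Sum using (_⊎_; inj₁; inj₂)
open import Function.Bundles using (mk⇔; Equivalence)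
open import Relation.Binary.Definitions using (DecidableEquality)
open import Relation.Binary.PropositionalEquality using (_≡_; _≢_; refl; sym; trans; cong; cong₂; subst; module ≡-Reasoning)
open import Relation.Nullary using (¬_; Dec; yes; no; ¬?; _×-dec_; _→-dec_)
open import Relation.Nullary.Decidable using (True; map′; toWitness; decidable-stable)
open import Relation.Unary using (Decidable)
open import Relation.Unary.Properties using (∁?)

open import Defs

module _ {A : Set} where

  length-∷ʳ : ∀ (xs : List A) x → length (xs ∷ʳ x) ≡ suc (length xs)
  length-∷ʳ xs x = trans (length-++ xs) (+-comm (length xs) 1)

  length-filter-∁ : ∀ {P : A → Set} (P? : Decidable P) xs →
                    length xs ≡ length (filter P? xs) + length (filter (∁? P?) xs)
  length-filter-∁ P? [] = refl
  length-filter-∁ P? (x ∷ xs) with P? x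
  ... | yes _ = cong suc (length-filter-∁ P? xs)
  ... | no _  = trans (cong suc (length-filter-∁ P? xs)) (sym (+-suc _ _))

  Unique-allEqual⇒length≤1 : ∀ {xs : List A} → Unique xs →
                             (∀ {x y} → x ∈ xs → y ∈ xs → x ≡ y) → length xs ≤ 1
  Unique-allEqual⇒length≤1 {[]}        _                  _     = z≤n
  Unique-allEqual⇒length≤1 {_ ∷ []}    _                  _     = s≤s z≤n
  Unique-allEqual⇒length≤1 {_ ∷ _ ∷ _} ((x≢y ∷ _) ∷ _) equal =
    ⊥-elim (x≢y (equal (here refl) (there (here refl))))

  ++-∷≢[] : ∀ (xs : List A) y ys → xs ++ y ∷ ys ≢ []
  ++-∷≢[] xs y ys eq with ++-conicalʳ xs (y ∷ ys) eq
  ... | ()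

  ++-assoc₃ : ∀ (ws xs ys zs : List A) → (ws ++ xs ++ ys) ++ zs ≡ ws ++ xs ++ ys ++ zs
  ++-assoc₃ ws xs ys zs = trans (++-assoc ws (xs ++ ys) zs) (cong (ws ++_) (++-assoc xs ys zs))

  applyUpTo-cong : ∀ {ψ χ : ℕ → A} → (∀ i → ψ i ≡ χ i) → ∀ n → applyUpTo ψ n ≡ applyUpTo χ n
  applyUpTo-cong {ψ} {χ} ψ≗χ n =
    trans (sym (map-upTo ψ n)) (trans (map-cong ψ≗χ (upTo n)) (map-upTo χ n))

module _ {k : ℕ} where

  _IsSuffixOf_ : Word k → Word k → Set
  p IsSuffixOf w = ∃[ y ] (y ++ p ≡ w)

  PalindromicFactor : Word k → Word k → Set
  PalindromicFactor w p = NonEmpty p × Palindrome p × p IsFactorOf w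

  isFactorOf-refl : ∀ (w : Word k) → w IsFactorOf w
  isFactorOf-refl w = [] , [] , ++-identityʳ w

  isFactorOf-[] : ∀ (p : Word k) → p IsFactorOf [] → p ≡ []
  isFactorOf-[] p (x , y , eq) = ++-conicalˡ p y (++-conicalʳ x (p ++ y) eq)

  isFactorOf-++ʳ : ∀ {p v : Word k} r → p IsFactorOf v → p IsFactorOf (v ++ r)
  isFactorOf-++ʳ {p} r (x , y , refl) = x , y ++ r , sym (++-assoc₃ x p y r)

  isFactorOf-trans : ∀ {p q w : Word k} → p IsFactorOf q → q IsFactorOf w → p IsFactorOf w
  isFactorOf-trans {p} (x , y , refl) (x′ , y′ , refl) = x′ ++ x , y ++ y′ , (begin
    (x′ ++ x) ++ p ++ y ++ y′   ≡⟨ ++-assoc x′ x (p ++ y ++ y′) ⟩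
    x′ ++ x ++ p ++ y ++ y′     ≡⟨ cong (x′ ++_) (sym (++-assoc₃ x p y y′)) ⟩
    x′ ++ (x ++ p ++ y) ++ y′   ∎)
    where open ≡-Reasoning

  isSuffixOf⇒isFactorOf : ∀ {p w : Word k} → p IsSuffixOf w → p IsFactorOf w
  isSuffixOf⇒isFactorOf {p} (y , eq) = y , [] , trans (cong (y ++_) (++-identityʳ p)) eq

  isFactorOf-∷ʳ : ∀ v c {p : Word k} → p IsFactorOf (v ∷ʳ c) → p IsFactorOf v ⊎ p IsSuffixOf (v ∷ʳ c)
  isFactorOf-∷ʳ v c {p} (x , y , eq) with reverseView y
  ... | [] = inj₂ (x , trans (cong (x ++_) (sym (++-identityʳ p))) eq)
  ... | y′ ∶ _ ∶ʳ e = inj₁ (x , y′ , proj₁ (∷ʳ-injective (x ++ p ++ y′) v (trans (++-assoc₃ x p y′ _) eq)))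

  newFactor-isSuffixOf : ∀ v c {p : Word k} → p IsFactorOf (v ∷ʳ c) → ¬ p IsFactorOf v → p IsSuffixOf (v ∷ʳ c)
  newFactor-isSuffixOf v c fac new with isFactorOf-∷ʳ v c fac
  ... | inj₁ old = ⊥-elim (new old)
  ... | inj₂ suf = suf

  suffixes-comparable : ∀ y p y′ q → y ++ p ≡ y′ ++ q → p IsSuffixOf q ⊎ q IsSuffixOf p
  suffixes-comparable []      p y′       q eq = inj₂ (y′ , sym eq)
  suffixes-comparable (a ∷ y) p []       q eq = inj₁ (a ∷ y , eq)
  suffixes-comparable (a ∷ y) p (b ∷ y′) q eq = suffixes-comparable y p y′ q (proj₂ (∷-injective eq))

  -- Mirroring q turns the suffix occurrence of p into a prefix occurrence, which ends
  -- before the last letter of q.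
  properPalindromicSuffix-isFactorOf : ∀ v c {p q : Word k} e z → Palindrome p → Palindrome q →
                                       (e ∷ z) ++ p ≡ q → q IsSuffixOf (v ∷ʳ c) → p IsFactorOf v
  properPalindromicSuffix-isFactorOf v c {p} {q} e z pal-p pal-q refl (y , q-suf) =
    y , reverse z , proj₁ (∷ʳ-injective (y ++ p ++ reverse z) v (begin
      (y ++ p ++ reverse z) ∷ʳ e     ≡⟨ ++-assoc₃ y p (reverse z) [ e ] ⟩
      y ++ p ++ reverse z ∷ʳ e       ≡⟨ cong (λ t → y ++ t ++ reverse z ∷ʳ e) (sym pal-p) ⟩
      y ++ reverse p ++ reverse z ∷ʳ e ≡⟨ cong (λ t → y ++ reverse p ++ t) (sym (unfold-reverse e z)) ⟩
      y ++ reverse p ++ reverse (e ∷ z) ≡⟨ cong (y ++_) (sym (reverse-++ (e ∷ z) p)) ⟩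
      y ++ reverse q                 ≡⟨ cong (y ++_) pal-q ⟩
      y ++ q                         ≡⟨ q-suf ⟩
      v ∷ʳ c                         ∎))
    where
    open ≡-Reasoning

  newPalindromicSuffix-unique : ∀ v c {p q : Word k} → p IsSuffixOf (v ∷ʳ c) → q IsSuffixOf (v ∷ʳ c) →
                                Palindrome p → Palindrome q → ¬ p IsFactorOf v → ¬ q IsFactorOf v → p ≡ q
  newPalindromicSuffix-unique v c {p} {q} (y , p-suf) (y′ , q-suf) pal-p pal-q new-p new-q
    with suffixes-comparable y p y′ q (trans p-suf (sym q-suf))
  ... | inj₁ ([] , p≡q)    = p≡q
  ... | inj₁ (e ∷ z , eq) = ⊥-elim (new-p (properPalindromicSuffix-isFactorOf v c e z pal-p pal-q eq (y′ , q-suf)))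
  ... | inj₂ ([] , q≡p)    = sym q≡p
  ... | inj₂ (e ∷ z , eq) = ⊥-elim (new-q (properPalindromicSuffix-isFactorOf v c e z pal-q pal-p eq (y , p-suf)))

  palindromicSuffix-∷ʳ : ∀ {p w : Word k} {c} → NonEmpty p → Palindrome p →
                         p IsSuffixOf (w ∷ʳ c) → ∃[ p′ ] (p ≡ c ∷ p′)
  palindromicSuffix-∷ʳ {p} {w} {c} nonempty pal (y , suf) with reverseView p
  ... | []              = ⊥-elim (nonempty refl)
  ... | p′ ∶ _ ∶ʳ e with proj₂ (∷ʳ-injective (y ++ p′) w (trans (++-assoc y p′ [ e ]) suf))
  ...   | refl = reverse p′ , trans (sym pal) (reverse-++ p′ [ e ])

  infix 4 _≟_
  _≟_ : DecidableEquality (Word k)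
  _≟_ = ≡-dec Fin._≟_

  palindrome? : ∀ (w : Word k) → Dec (Palindrome w)
  palindrome? w = reverse w ≟ w

  isPrefixOf? : ∀ (p w : Word k) → Dec (∃[ y ] (p ++ y ≡ w))
  isPrefixOf? []      w       = yes (w , refl)
  isPrefixOf? (a ∷ p) []      = no λ { (_ , ()) }
  isPrefixOf? (a ∷ p) (b ∷ w) with a Fin.≟ b | isPrefixOf? p w
  ... | no a≢b  | _               = no λ { (_ , eq) → a≢b (proj₁ (∷-injective eq)) }
  ... | yes _   | no ¬pre         = no λ { (y , eq) → ¬pre (y , proj₂ (∷-injective eq)) }
  ... | yes refl | yes (y , eq)   = yes (y , cong (a ∷_) eq)

  anySuffix? : ∀ {P : Word k → Set} → Decidable P → ∀ w → Dec (∃[ p ] (p IsSuffixOf w × P p))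
  anySuffix? P? w with P? w
  ... | yes Pw = yes (w , ([] , refl) , Pw)
  anySuffix? P? []      | no ¬P[] = no λ { (_ , ([] , refl) , P[]) → ¬P[] P[] ; (_ , (_ ∷ _ , ()) , _) }
  anySuffix? P? (a ∷ w) | no ¬Pw with anySuffix? P? w
  ... | yes (p , (y , eq) , Pp) = yes (p , (a ∷ y , cong (a ∷_) eq) , Pp)
  ... | no none = no λ { (_ , ([] , refl) , Pw) → ¬Pw Pw
                       ; (p , (_ ∷ y , eq) , Pp) → none (p , (y , proj₂ (∷-injective eq)) , Pp) }

  isFactorOf? : ∀ (p w : Word k) → Dec (p IsFactorOf w)
  isFactorOf? p w = map′ fromSuffix toSuffix (anySuffix? (isPrefixOf? p) w)
    where
    fromSuffix : ∃[ s ] (s IsSuffixOf w × ∃[ y ] (p ++ y ≡ s)) → p IsFactorOf w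
    fromSuffix (_ , (x , x++s≡w) , (y , refl)) = x , y , x++s≡w
    toSuffix : p IsFactorOf w → ∃[ s ] (s IsSuffixOf w × ∃[ y ] (p ++ y ≡ s))
    toSuffix (x , y , eq) = p ++ y , (x , eq) , (y , refl)

  newPalindromes-length≤1 : ∀ v c (L : List (Word k)) → Unique L →
                            (∀ {p : Word k} → p ∈ L → PalindromicFactor (v ∷ʳ c) p × ¬ p IsFactorOf v) →
                            length L ≤ 1
  newPalindromes-length≤1 v c L uniq new = Unique-allEqual⇒length≤1 uniq λ p∈L q∈L → same (new p∈L) (new q∈L)
    where
    same : ∀ {p q : Word k} → PalindromicFactor (v ∷ʳ c) p × ¬ p IsFactorOf v →
           PalindromicFactor (v ∷ʳ c) q × ¬ q IsFactorOf v → p ≡ q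
    same ((_ , pal-p , fac-p) , new-p) ((_ , pal-q , fac-q) , new-q) =
      newPalindromicSuffix-unique v c (newFactor-isSuffixOf v c fac-p new-p)
        (newFactor-isSuffixOf v c fac-q new-q) pal-p pal-q new-p new-q

  palindromicFactors-length≤ : ∀ {w : Word k} → Reverse w → (L : List (Word k)) → Unique L →
                               (∀ {p : Word k} → p ∈ L → PalindromicFactor w p) → length L ≤ length w
  palindromicFactors-length≤ [] []      _ _   = z≤n
  palindromicFactors-length≤ [] (p ∷ _) _ pal with pal (here refl)
  ... | nonempty , _ , fac = ⊥-elim (nonempty (isFactorOf-[] p fac))
  palindromicFactors-length≤ (v ∶ rv ∶ʳ c) L uniq pal = begin
    length L                                              ≡⟨ length-filter-∁ old? L ⟩
    length (filter old? L) + length (filter (∁? old?) L)  ≤⟨ +-mono-≤ old-bound new-bound ⟩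
    length v + 1                                          ≡⟨ sym (length-++ v) ⟩
    length (v ∷ʳ c)                                       ∎
    where
    open Data.Nat.Properties.≤-Reasoning
    old? : Decidable (_IsFactorOf v)
    old? p = isFactorOf? p v
    old-bound : length (filter old? L) ≤ length v
    old-bound = palindromicFactors-length≤ rv (filter old? L) (filter⁺ old? uniq) λ p∈ →
      let p∈L , old = ∈-filter⁻ old? p∈
          nonempty , pal-p , _ = pal p∈L
      in nonempty , pal-p , old
    new-bound : length (filter (∁? old?) L) ≤ 1
    new-bound = newPalindromes-length≤1 v c (filter (∁? old?) L) (filter⁺ (∁? old?) uniq) λ p∈ →
      let p∈L , new = ∈-filter⁻ (∁? old?) p∈ in pal p∈L , new

  NoNewPalindrome : Word k → Alph k → Set
  NoNewPalindrome v a = ∀ p → NonEmpty p → Palindrome p → p IsSuffixOf (v ∷ʳ a) → p IsFactorOf v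

  HasDefect : Word k → Set
  HasDefect w = ∃[ v ] ∃[ a ] (NoNewPalindrome v a × (v ∷ʳ a) IsFactorOf w)

  noNewPalindrome⇒¬rich : ∀ v a → NoNewPalindrome v a → ¬ Rich (v ∷ʳ a)
  noNewPalindrome⇒¬rich v a noNew (L , uniq , len , enum) =
    1+n≰n (≤-trans (≤-reflexive (trans (sym (length-∷ʳ v a)) (sym len))) bound)
    where
    old : ∀ p → PalindromicFactor (v ∷ʳ a) p → PalindromicFactor v p
    old p (nonempty , pal-p , fac) with isFactorOf-∷ʳ v a fac
    ... | inj₁ fac-v = nonempty , pal-p , fac-v
    ... | inj₂ suf   = nonempty , pal-p , noNew p nonempty pal-p suf
    bound : length L ≤ length v
    bound = palindromicFactors-length≤ (reverseView v) L uniq λ {p} p∈L → old p (Equivalence.to (enum p) p∈L)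

  rich-∷ʳ : ∀ w a → Rich w → Rich (w ∷ʳ a) ⊎ NoNewPalindrome w a
  rich-∷ʳ w a (L , uniq , len , enum)
    with anySuffix? (λ p → ¬? (p ≟ []) ×-dec palindrome? p ×-dec ¬? (isFactorOf? p w)) (w ∷ʳ a)
  ... | no none = inj₂ λ p nonempty pal-p suf →
    decidable-stable (isFactorOf? p w) λ new → none (p , suf , nonempty , pal-p , new)
  ... | yes (q , suf-q , nonempty-q , pal-q , new-q) =
    inj₁ (q ∷ L , All.tabulate q∉L ∷ uniq , trans (cong suc len) (sym (length-∷ʳ w a)) , λ p → mk⇔ (to p) (from p))
    where
    q∉L : ∀ {p : Word k} → p ∈ L → q ≢ p
    q∉L q∈L refl = new-q (proj₂ (proj₂ (Equivalence.to (enum q) q∈L)))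
    to : ∀ p → p ∈ q ∷ L → PalindromicFactor (w ∷ʳ a) p
    to p (here refl)  = nonempty-q , pal-q , isSuffixOf⇒isFactorOf suf-q
    to p (there p∈L) = let nonempty , pal-p , fac = Equivalence.to (enum p) p∈L
                       in nonempty , pal-p , isFactorOf-++ʳ _ fac
    from : ∀ p → PalindromicFactor (w ∷ʳ a) p → p ∈ q ∷ L
    from p (nonempty , pal-p , fac) with isFactorOf? p w
    ... | yes old = there (Equivalence.from (enum p) (nonempty , pal-p , old))
    ... | no new  = here (newPalindromicSuffix-unique w a (newFactor-isSuffixOf w a fac new) suf-q pal-p pal-q new new-q)

  rich⊎hasDefect : ∀ {w : Word k} → Reverse w → Rich w ⊎ HasDefect w
  rich⊎hasDefect [] = inj₁ ([] , [] , refl , λ p → mk⇔ (λ ()) λ (nonempty , _ , fac) → ⊥-elim (nonempty (isFactorOf-[] p fac)))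
  rich⊎hasDefect (w ∶ rw ∶ʳ a) with rich⊎hasDefect rw
  ... | inj₂ (v , b , noNew , fac) = inj₂ (v , b , noNew , isFactorOf-++ʳ _ fac)
  ... | inj₁ rich with rich-∷ʳ w a rich
  ...   | inj₁ rich′ = inj₁ rich′
  ...   | inj₂ noNew = inj₂ (w , a , noNew , isFactorOf-refl (w ∷ʳ a))

lookupD-++ˡ : ∀ {k} (d : Alph k) xs ys n → n < length xs → lookupD d (xs ++ ys) n ≡ lookupD d xs n
lookupD-++ˡ d (x ∷ xs) ys zero    _         = refl
lookupD-++ˡ d (x ∷ xs) ys (suc n) (s≤s n<) = lookupD-++ˡ d xs ys n n<

lookupD-++-∷ : ∀ {k} (d : Alph k) xs c ys → lookupD d (xs ++ c ∷ ys) (length xs) ≡ c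
lookupD-++-∷ d []       c ys = refl
lookupD-++-∷ d (x ∷ xs) c ys = lookupD-++-∷ d xs c ys

module _ {m : ℕ} (u : InfWord m) where

  prefix-+ : ∀ i n → prefix u (i + n) ≡ prefix u i ++ factor u i n
  prefix-+ i zero    = trans (cong (prefix u) (+-identityʳ i)) (sym (++-identityʳ (prefix u i)))
  prefix-+ i (suc n) = begin
    prefix u (i + suc n)                   ≡⟨ cong (prefix u) (+-suc i n) ⟩
    prefix u (suc (i + n))                 ≡⟨ sym (applyUpTo-∷ʳ u (i + n)) ⟩
    prefix u (i + n) ∷ʳ u (i + n)          ≡⟨ cong (_∷ʳ u (i + n)) (prefix-+ i n) ⟩
    (prefix u i ++ factor u i n) ∷ʳ u (i + n) ≡⟨ ++-assoc (prefix u i) (factor u i n) [ u (i + n) ] ⟩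
    prefix u i ++ factor u i n ∷ʳ u (i + n) ≡⟨ cong (prefix u i ++_) (applyUpTo-∷ʳ (λ j → u (i + j)) n) ⟩
    prefix u i ++ factor u i (suc n)       ∎
    where open ≡-Reasoning

  factor-suc : ∀ i n → factor u i (suc n) ≡ u i ∷ factor u (suc i) n
  factor-suc i n = cong₂ _∷_ (cong u (+-identityʳ i)) (applyUpTo-cong (λ j → cong u (+-suc i j)) n)

  factor-isFactorOf-prefix : ∀ i n → factor u i n IsFactorOf prefix u (i + n)
  factor-isFactorOf-prefix i n =
    prefix u i , [] , trans (cong (prefix u i ++_) (++-identityʳ (factor u i n))) (sym (prefix-+ i n))

module _ {m k} (φ : Morphism m (suc k)) (nonerasing : ∀ a → 1 ≤ length (φ a)) where

  length≤length-applyFin : ∀ w → length w ≤ length (applyFin φ w)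
  length≤length-applyFin []      = z≤n
  length≤length-applyFin (a ∷ w) =
    ≤-trans (+-mono-≤ (nonerasing a) (length≤length-applyFin w)) (≤-reflexive (sym (length-++ (φ a))))

  applyFin-prefix-≤ : ∀ u {i j} → i ≤ j → ∃[ r ] (applyFin φ (prefix u j) ≡ applyFin φ (prefix u i) ++ r)
  applyFin-prefix-≤ u {i} i≤j with m≤n⇒∃[o]m+o≡n i≤j
  ... | n , refl = applyFin φ (factor u i n) , trans (cong (applyFin φ) (prefix-+ u i n)) (concatMap-++ φ (prefix u i) _)

  applyInf-lookupD : ∀ u M n → n < length (applyFin φ (prefix u M)) →
                     applyInf φ u n ≡ lookupD `0 (applyFin φ (prefix u M)) n
  applyInf-lookupD u M n n<M with ≤-total (suc n) M
  ... | inj₁ n<M′ with applyFin-prefix-≤ u n<M′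
  ...   | r , eq = sym (trans (cong (λ t → lookupD `0 t n) eq) (lookupD-++ˡ `0 (applyFin φ (prefix u (suc n))) r n n<image))
    where
    n<image : n < length (applyFin φ (prefix u (suc n)))
    n<image = ≤-trans (≤-reflexive (sym (length-applyUpTo u (suc n)))) (length≤length-applyFin (prefix u (suc n)))
  applyInf-lookupD u M n n<M | inj₂ M≤n with applyFin-prefix-≤ u M≤n
  ...   | r , eq = trans (cong (λ t → lookupD `0 t n) eq) (lookupD-++ˡ `0 (applyFin φ (prefix u M)) r n n<M)

  applyInf-at : ∀ u M x c y → x ++ c ∷ y ≡ applyFin φ (prefix u M) → applyInf φ u (length x) ≡ c
  applyInf-at u M x c y eq = begin
    applyInf φ u (length x)                           ≡⟨ applyInf-lookupD u M (length x) x<M ⟩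
    lookupD `0 (applyFin φ (prefix u M)) (length x)  ≡⟨ cong (λ t → lookupD `0 t (length x)) (sym eq) ⟩
    lookupD `0 (x ++ c ∷ y) (length x)               ≡⟨ lookupD-++-∷ `0 x c y ⟩
    c                                                ∎
    where
    open ≡-Reasoning
    x<M : length x < length (applyFin φ (prefix u M))
    x<M = subst (λ t → length x < length t) eq
            (subst (length x <_) (sym (length-++ x)) (m<m+n (length x) (s≤s z≤n)))

  applyInf-factor : ∀ u M x W y → x ++ W ++ y ≡ applyFin φ (prefix u M) →
                    W ≡ factor (applyInf φ u) (length x) (length W)
  applyInf-factor u M x []      y eq = refl
  applyInf-factor u M x (c ∷ W) y eq = begin
    c ∷ W                                           ≡⟨ cong₂ _∷_ (sym (applyInf-at u M x c (W ++ y) eq)) rest ⟩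
    Φ (length x) ∷ factor Φ (suc (length x)) (length W) ≡⟨ sym (factor-suc Φ (length x) (length W)) ⟩
    factor Φ (length x) (suc (length W))            ∎
    where
    open ≡-Reasoning
    Φ = applyInf φ u
    rest : W ≡ factor Φ (suc (length x)) (length W)
    rest = trans (applyInf-factor u M (x ∷ʳ c) W y (trans (++-assoc x [ c ] (W ++ y)) eq))
                 (cong (λ i → factor Φ i (length W)) (length-∷ʳ x c))

  richInf-image⇒rich : ∀ u {W M} → RichInf (applyInf φ u) → W IsFactorOf applyFin φ (prefix u M) → Rich W
  richInf-image⇒rich u {W} {M} richΦ (x , y , eq) = subst Rich (sym (applyInf-factor u M x W y eq)) (richΦ _ _)

ZeroFree : ∀ {k} → Word (suc k) → Set
ZeroFree = All (_≢ `0)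

module _ {k : ℕ} where

  zeroFree-++-∷-cancel : ∀ {s₁ s₂ r₁ r₂ : Word (suc k)} → ZeroFree s₁ → ZeroFree s₂ →
                         s₁ ++ `0 ∷ r₁ ≡ s₂ ++ `0 ∷ r₂ → s₁ ≡ s₂ × r₁ ≡ r₂
  zeroFree-++-∷-cancel {[]}    {[]}    _          _          eq = refl , proj₂ (∷-injective eq)
  zeroFree-++-∷-cancel {[]}    {_ ∷ _} _          (b≢0 ∷ _) eq = ⊥-elim (b≢0 (sym (proj₁ (∷-injective eq))))
  zeroFree-++-∷-cancel {_ ∷ _} {[]}    (a≢0 ∷ _) _          eq = ⊥-elim (a≢0 (proj₁ (∷-injective eq)))
  zeroFree-++-∷-cancel {a ∷ _} {_ ∷ _} (_ ∷ z₁)  (_ ∷ z₂)  eq with ∷-injective eq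
  ... | refl , eq′ with zeroFree-++-∷-cancel z₁ z₂ eq′
  ...   | refl , r₁≡r₂ = refl , r₁≡r₂

  zeroFree-++-isSuffixOf : ∀ {s : Word (suc k)} y p r → ZeroFree s →
                           y ++ `0 ∷ p ≡ s ++ r → (`0 ∷ p) IsSuffixOf r
  zeroFree-++-isSuffixOf y       p r []         eq = y , eq
  zeroFree-++-isSuffixOf []      p r (c≢0 ∷ _) eq = ⊥-elim (c≢0 (sym (proj₁ (∷-injective eq))))
  zeroFree-++-isSuffixOf (_ ∷ y) p r (_ ∷ z)   eq = zeroFree-++-isSuffixOf y p r z (proj₂ (∷-injective eq))

letterBody : ∀ {m k} → Morphism m k → Alph m → Word k
letterBody φ a = drop 1 (φ a)

-- Class P of Hof, Knill and Simon with the palindrome 0: φ(a) = 0 sₐ with sₐ a palindrome.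
-- Zero-freeness and injectivity of a ↦ sₐ make φ(w)0 decodable.
record ZeroPalindromic {m k} (φ : Morphism m (suc k)) : Set where
  constructor mkZeroPalindromic
  field
    letter≡0∷body   : ∀ a → φ a ≡ `0 ∷ letterBody φ a
    body-zeroFree   : ∀ a → ZeroFree (letterBody φ a)
    body-palindrome : ∀ a → Palindrome (letterBody φ a)
    body-injective  : ∀ a b → letterBody φ a ≡ letterBody φ b → a ≡ b

zeroPalindromic? : ∀ {m k} (φ : Morphism m (suc k)) → Dec (ZeroPalindromic φ)
zeroPalindromic? φ =
  map′ (λ (s , z , p , i) → mkZeroPalindromic s z p i)
       (λ (mkZeroPalindromic s z p i) → s , z , p , i)
       (Fin.all? (λ a → φ a ≟ `0 ∷ body a)
        ×-dec Fin.all? (λ a → All.all? (λ x → ¬? (x Fin.≟ `0)) (body a))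
        ×-dec Fin.all? (λ a → palindrome? (body a))
        ×-dec Fin.all? (λ a → Fin.all? λ b → (body a ≟ body b) →-dec (a Fin.≟ b)))
  where body = letterBody φ

module ZeroPalindromicMorphism {m k} {φ : Morphism m (suc k)} (zp : ZeroPalindromic φ) where
  open ZeroPalindromic zp

  private
    body : Alph m → Word (suc k)
    body = letterBody φ

  closedImage : Word m → Word (suc k)
  closedImage x = applyFin φ x ∷ʳ `0

  closedImage≢[] : ∀ x → closedImage x ≢ []
  closedImage≢[] x = ++-∷≢[] (applyFin φ x) `0 []

  closedImage-∷ : ∀ a x → closedImage (a ∷ x) ≡ `0 ∷ body a ++ closedImage x
  closedImage-∷ a x =
    trans (cong (λ t → (t ++ applyFin φ x) ∷ʳ `0) (letter≡0∷body a))
          (cong (`0 ∷_) (++-assoc (body a) (applyFin φ x) [ `0 ]))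

  closedImage-head : ∀ x → ∃[ r ] (closedImage x ≡ `0 ∷ r)
  closedImage-head []      = [] , refl
  closedImage-head (a ∷ x) = body a ++ closedImage x , closedImage-∷ a x

  closedImage-++ : ∀ x y → closedImage (x ++ y) ≡ applyFin φ x ++ closedImage y
  closedImage-++ x y =
    trans (cong (_∷ʳ `0) (concatMap-++ φ x y)) (++-assoc (applyFin φ x) (applyFin φ y) [ `0 ])

  applyFin-∷ʳ : ∀ x a → applyFin φ (x ∷ʳ a) ≡ closedImage x ++ body a
  applyFin-∷ʳ x a = begin
    applyFin φ (x ∷ʳ a)               ≡⟨ concatMap-++ φ x [ a ] ⟩
    applyFin φ x ++ φ a ++ []          ≡⟨ cong (λ t → applyFin φ x ++ t) (++-identityʳ (φ a)) ⟩
    applyFin φ x ++ φ a                ≡⟨ cong (applyFin φ x ++_) (letter≡0∷body a) ⟩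
    applyFin φ x ++ `0 ∷ body a        ≡⟨ sym (++-assoc (applyFin φ x) [ `0 ] (body a)) ⟩
    closedImage x ++ body a            ∎
    where open ≡-Reasoning

  closedImage-isFactorOf-∷ʳ : ∀ x a → closedImage x IsFactorOf applyFin φ (x ∷ʳ a)
  closedImage-isFactorOf-∷ʳ x a = [] , body a , sym (applyFin-∷ʳ x a)

  closedImage-isFactorOf : ∀ {q v} → q IsFactorOf v → closedImage q IsFactorOf closedImage v
  closedImage-isFactorOf {q} (α , β , refl) with closedImage-head β
  ... | r , eq = applyFin φ α , r , (begin
    applyFin φ α ++ closedImage q ++ r          ≡⟨ cong (applyFin φ α ++_) (++-assoc (applyFin φ q) [ `0 ] r) ⟩
    applyFin φ α ++ applyFin φ q ++ `0 ∷ r      ≡⟨ cong (λ t → applyFin φ α ++ applyFin φ q ++ t) (sym eq) ⟩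
    applyFin φ α ++ applyFin φ q ++ closedImage β ≡⟨ cong (applyFin φ α ++_) (sym (closedImage-++ q β)) ⟩
    applyFin φ α ++ closedImage (q ++ β)         ≡⟨ sym (closedImage-++ α (q ++ β)) ⟩
    closedImage (α ++ q ++ β)                    ∎)
    where open ≡-Reasoning

  closedImage-reverse : ∀ x → reverse (closedImage x) ≡ closedImage (reverse x)
  closedImage-reverse []      = refl
  closedImage-reverse (a ∷ x) = begin
    reverse (closedImage (a ∷ x))                   ≡⟨ cong reverse (closedImage-∷ a x) ⟩
    reverse (`0 ∷ body a ++ closedImage x)           ≡⟨ unfold-reverse `0 (body a ++ closedImage x) ⟩
    reverse (body a ++ closedImage x) ∷ʳ `0          ≡⟨ cong (_∷ʳ `0) (reverse-++ (body a) (closedImage x)) ⟩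
    (reverse (closedImage x) ++ reverse (body a)) ∷ʳ `0
      ≡⟨ cong₂ (λ s t → (s ++ t) ∷ʳ `0) (closedImage-reverse x) (body-palindrome a) ⟩
    (closedImage (reverse x) ++ body a) ∷ʳ `0        ≡⟨ cong (_∷ʳ `0) (sym (applyFin-∷ʳ (reverse x) a)) ⟩
    closedImage (reverse x ∷ʳ a)                    ≡⟨ cong closedImage (sym (unfold-reverse a x)) ⟩
    closedImage (reverse (a ∷ x))                   ∎
    where open ≡-Reasoning

  closedImage-injective : ∀ x y → closedImage x ≡ closedImage y → x ≡ y
  closedImage-injective []      []      _  = refl
  closedImage-injective []      (b ∷ y) eq =
    ⊥-elim (closedImage≢[] y (++-conicalʳ (body b) _ (sym (proj₂ (∷-injective (trans eq (closedImage-∷ b y)))))))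
  closedImage-injective (a ∷ x) []      eq =
    ⊥-elim (closedImage≢[] x (++-conicalʳ (body a) _ (proj₂ (∷-injective (trans (sym (closedImage-∷ a x)) eq)))))
  closedImage-injective (a ∷ x) (b ∷ y) eq
    with closedImage-head x | closedImage-head y
  ... | r , ex | r′ , ey
    with zeroFree-++-∷-cancel (body-zeroFree a) (body-zeroFree b) (begin
      body a ++ `0 ∷ r       ≡⟨ cong (body a ++_) (sym ex) ⟩
      body a ++ closedImage x ≡⟨ proj₂ (∷-injective (trans (sym (closedImage-∷ a x)) (trans eq (closedImage-∷ b y)))) ⟩
      body b ++ closedImage y ≡⟨ cong (body b ++_) ey ⟩
      body b ++ `0 ∷ r′      ∎)
    where open ≡-Reasoning
  ... | sₐ≡s_b , r≡r′ with body-injective a b sₐ≡s_b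
  ... | refl = cong (a ∷_) (closedImage-injective x y (trans ex (trans (cong (`0 ∷_) r≡r′) (sym ey))))

  -- The 0s of φ(x)0 sit exactly at the letter boundaries, so a suffix starting with 0
  -- cuts x between two letters.
  closedImage-isSuffixOf : ∀ x {p} → (`0 ∷ p) IsSuffixOf closedImage x →
                           ∃[ q ] (q IsSuffixOf x × `0 ∷ p ≡ closedImage q)
  closedImage-isSuffixOf []      ([] , eq)    = [] , ([] , refl) , eq
  closedImage-isSuffixOf []      {p} (_ ∷ y , eq) = ⊥-elim (++-∷≢[] y `0 p (proj₂ (∷-injective eq)))
  closedImage-isSuffixOf (a ∷ x) ([] , eq)    = a ∷ x , ([] , refl) , eq
  closedImage-isSuffixOf (a ∷ x) {p} (_ ∷ y , eq)
    with closedImage-isSuffixOf x (zeroFree-++-isSuffixOf y p (closedImage x) (body-zeroFree a)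
                                     (proj₂ (∷-injective (trans eq (closedImage-∷ a x)))))
  ... | q , (z , suf) , eq-q = q , (a ∷ z , cong (a ∷_) suf) , eq-q

  noNewPalindrome-image : ∀ v a → NoNewPalindrome v a → NoNewPalindrome (applyFin φ (v ∷ʳ a)) `0
  noNewPalindrome-image v a noNew p nonempty pal suf with palindromicSuffix-∷ʳ nonempty pal suf
  ... | p′ , refl with closedImage-isSuffixOf (v ∷ʳ a) suf
  ... | q , suf-q , p≡q̂ =
    subst (_IsFactorOf applyFin φ (v ∷ʳ a)) (sym p≡q̂)
          (isFactorOf-trans (closedImage-isFactorOf (old q suf-q pal-q)) (closedImage-isFactorOf-∷ʳ v a))
    where
    pal-q : Palindrome q
    pal-q = closedImage-injective (reverse q) q
              (trans (sym (closedImage-reverse q)) (trans (cong reverse (sym p≡q̂)) (trans pal p≡q̂)))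
    old : ∀ q → q IsSuffixOf (v ∷ʳ a) → Palindrome q → q IsFactorOf v
    old []      _   _     = [] , v , refl
    old (b ∷ q) suf pal-q = noNew (b ∷ q) (λ ()) pal-q suf

  nonerasing : ∀ a → 1 ≤ length (φ a)
  nonerasing a rewrite letter≡0∷body a = s≤s z≤n

  richInf-preimage : ∀ u → RichInf (applyInf φ u) → RichInf u
  richInf-preimage u richΦ i n with rich⊎hasDefect (reverseView (factor u i n))
  ... | inj₁ rich = rich
  ... | inj₂ (v , a , noNew , va⊑) =
    ⊥-elim (noNewPalindrome⇒¬rich _ `0 (noNewPalindrome-image v a noNew)
              (richInf-image⇒rich φ nonerasing u {M = suc (i + n)} richΦ image⊑))
    where
    image⊑ : closedImage (v ∷ʳ a) IsFactorOf applyFin φ (prefix u (suc (i + n)))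
    image⊑ = subst (λ w → closedImage (v ∷ʳ a) IsFactorOf applyFin φ w) (applyUpTo-∷ʳ u (i + n))
      (isFactorOf-trans (closedImage-isFactorOf (isFactorOf-trans va⊑ (factor-isFactorOf-prefix u i n)))
                        (closedImage-isFactorOf-∷ʳ (prefix u (i + n)) (u (i + n))))

corollary6 : (∀ (u : InfWord 3) → RichInf (applyInf f u) → RichInf u)
           × (∀ (u : InfWord 3) → RichInf (applyInf g u) → RichInf u)
           × (∀ (u : InfWord 3) → RichInf (applyInf h u) → RichInf u)
corollary6 = preimage f , preimage g , preimage h
  where
  preimage : ∀ {k} (φ : Morphism 3 (suc k)) {_ : True (zeroPalindromic? φ)} → ∀ u → RichInf (applyInf φ u) → RichInf u
  preimage φ {zp} = ZeroPalindromicMorphism.richInf-preimage (toWitness zp)
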